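{- Let $S_2=\{p \text{ prime} : p\equiv 1 \bmod 8 \text{ or } p\equiv 3 \bmod 8\}$ and $P_{S_2}=\{p \text{ prime} : p=x^2+2y^2+1 \text{ for some } x,y\in\mathbb{Z} \text{ with } \gcd(x,y)=1\}$. Then every $p\in P_{S_2}$ satisfies $(p-1)_{S_2}\geq (p-1)/2$.
   Context: For a set $S$ of primes and a natural number $n$, $n_S$ denotes the largest divisor of $n$ all of whose prime factors lie in $S$. -}

module Defs where

open import Data.Nat using (ℕ; _≤_; _%_)
open import Data.Nat.Divisibility using (_∣_)
open import Data.Nat.Primality using (Prime)
open import Data.Integer as ℤ using (ℤ; +_)
open import Data.Integer.GCD using (gcd)
open import Data.Product using (∃; ∃-syntax; _×_)
open import Data.Sum using (_⊎_)
open import Relation.Binary.PropositionalEquality using (_≡_)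
open import Relation.Unary using (Pred)
open import Level using (0ℓ)

-- a set of primes is modelled as a predicate on ℕ (only its primes matter)
PrimeSet : Set₁
PrimeSet = Pred ℕ 0ℓ

AllPrimeFactorsIn : PrimeSet → ℕ → Set
AllPrimeFactorsIn S d = ∀ q → Prime q → q ∣ d → S q

IsSPart : PrimeSet → ℕ → ℕ → Set
IsSPart S n d =
  d ∣ n × AllPrimeFactorsIn S d ×
  (∀ e → e ∣ n → AllPrimeFactorsIn S e → e ≤ d)

S₂ : PrimeSet
S₂ p = Prime p × (p % 8 ≡ 1 ⊎ p % 8 ≡ 3)

P-S₂ : PrimeSet
P-S₂ p = Prime p ×
  ∃[ x ] ∃[ y ] ((+ p ≡ x ℤ.* x ℤ.+ (+ 2) ℤ.* (y ℤ.* y) ℤ.+ (+ 1)) × gcd x y ≡ + 1)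

{-# OPTIONS --safe #-}
module Submission where

-- Let q be an odd prime dividing x² + 2y² with gcd(x, y) = 1; then q ∤ y. By Thue's lemma
-- there are u, v, not both 0, with |u|, |v| < √q and q ∣ uy − vx, and then
-- y²(u² + 2v²) = (uy − vx)(uy + vx) + v²(x² + 2y²) gives q ∣ u² + 2v² < 3q. So q or 2q is
-- of the form a² + 2b², hence so is q, and an odd number of that form is 1 or 3 mod 8.
-- Thus every odd prime factor of p − 1 = x² + 2y² lies in S₂. As x and y are coprime,
-- 4 ∤ x² + 2y², so the S₂-part of p − 1 is its odd part, which is at least (p − 1)/2.

open import Defs
open import Data.Nat using (ℕ; _∸_; _*_; _≤_)
open import Data.Product using (∃-syntax; _×_)

open import Data.Nat.Base
  using (zero; suc; _+_; _^_; _<_; _⊔_; _%_; _/_; NonZero; ≢-nonZero; z≤n; s≤s; s≤s⁻¹)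
open import Data.Nat.Properties
open import Data.Nat.DivMod using (m≡m%n+[m/n]*n; [m+kn]%n≡m%n; m%n<n; m∣n⇒o%n%m≡o%m)
open import Data.Nat.Divisibility
  using (_∣_; divides; _∣?_; ∣-trans; ∣⇒≤; n∣m*n; m∣m*n; ∣m⇒∣m*n; ∣n⇒∣m*n; ∣m+n∣m⇒∣n; m%n≡0⇒n∣m)
open import Data.Nat.Primality
  using (Prime; prime⇒irreducible; prime⇒nonZero; euclidsLemma; prime[2]; ¬prime[1])
open import Data.Nat.Coprimality using (Coprime; coprime-divisor; gcd≡1⇒coprime)
open import Data.Nat.Tactic.RingSolver using (solve-∀)
open import Data.Integer.Base as ℤ using (ℤ; +_; -[1+_]; 0ℤ; ∣_∣)
import Data.Integer.Properties as ℤₚ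
import Data.Integer.DivMod as ℤ
import Data.Integer.Divisibility.Signed as ℤ∣
import Data.Integer.Tactic.RingSolver as ℤ-Solver
open import Data.Fin.Base using (Fin; toℕ; fromℕ<; remQuot; combine)
import Data.Fin.Properties as Finₚ
open import Data.Product using (_,_; map; uncurry; ∃₂)
open import Data.Sum using (_⊎_; inj₁; inj₂)
open import Function.Base using (_∘_)
open import Relation.Nullary using (¬_; Dec; yes; no; contradiction)
open import Relation.Nullary.Decidable using (_→-dec_; _⊎-dec_; toWitness)
open import Relation.Binary.PropositionalEquality

prime∤⇒coprime : ∀ {p n} → Prime p → ¬ p ∣ n → Coprime n p
prime∤⇒coprime p-prime p∤n (i∣n , i∣p) with prime⇒irreducible p-prime i∣p
... | inj₁ i≡1  = i≡1
... | inj₂ refl = contradiction i∣n p∤n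

prime∣*∧∤⇒∣ : ∀ {p} m {n} → Prime p → ¬ p ∣ m → p ∣ m * n → p ∣ n
prime∣*∧∤⇒∣ m p-prime p∤m p∣mn with euclidsLemma m _ p-prime p∣mn
... | inj₁ p∣m = contradiction p∣m p∤m
... | inj₂ p∣n = p∣n

prime∣²⇒∣ : ∀ {p} m → Prime p → p ∣ m * m → p ∣ m
prime∣²⇒∣ m p-prime p∣m² with euclidsLemma m m p-prime p∣m²
... | inj₁ p∣m = p∣m
... | inj₂ p∣m = p∣m

prime⇒≢square : ∀ {p} m → Prime p → m * m ≢ p
prime⇒≢square {p} m p-prime m²≡p with prime⇒irreducible p-prime (divides m (sym m²≡p))
... | inj₁ refl = ¬prime[1] (subst Prime (sym m²≡p) p-prime)
... | inj₂ refl = ¬prime[1] (subst Prime m≡1 p-prime)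
  where
  instance
    p≢0 : NonZero p
    p≢0 = prime⇒nonZero p-prime
  m≡1 : m ≡ 1
  m≡1 = *-cancelʳ-≡ m 1 m (trans m²≡p (sym (*-identityˡ m)))

prime≢2⇒¬2∣ : ∀ {p} → Prime p → p ≢ 2 → ¬ 2 ∣ p
prime≢2⇒¬2∣ p-prime p≢2 2∣p with prime⇒irreducible p-prime 2∣p
... | inj₁ ()
... | inj₂ 2≡p = p≢2 (sym 2≡p)

¬2∣⇒%2≡1 : ∀ m → ¬ 2 ∣ m → m % 2 ≡ 1
¬2∣⇒%2≡1 m 2∤m with m % 2 in eq | m%n<n m 2
... | 0           | _            = contradiction (m%n≡0⇒n∣m m 2 eq) 2∤m
... | 1           | _            = refl
... | suc (suc _) | s≤s (s≤s ())

coprime-divisor-^ : ∀ {m n o} → Coprime m n → ∀ k → m ∣ n ^ k * o → m ∣ o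
coprime-divisor-^ {m} {n} {o} m⊥n zero    m∣1*o     = subst (m ∣_) (*-identityˡ o) m∣1*o
coprime-divisor-^ {m} {n} {o} m⊥n (suc k) m∣n*n^k*o =
  coprime-divisor-^ m⊥n k (coprime-divisor m⊥n (subst (m ∣_) (*-assoc n (n ^ k) o) m∣n*n^k*o))

floor-sqrt : ∀ n → ∃[ s ] (s * s ≤ n × n < suc s * suc s)
floor-sqrt zero = 0 , z≤n , s≤s z≤n
floor-sqrt (suc n) with floor-sqrt n
... | s , s²≤n , n<[1+s]² with suc n <? suc s * suc s
...   | yes 1+n<[1+s]² = s , m≤n⇒m≤1+n s²≤n , 1+n<[1+s]²
...   | no  1+n≮[1+s]² = suc s , ≤-reflexive (sym 1+n≡[1+s]²) , 1+n<[2+s]²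
  where
  1+n≡[1+s]² : suc n ≡ suc s * suc s
  1+n≡[1+s]² = ≤-antisym n<[1+s]² (≮⇒≥ 1+n≮[1+s]²)
  1+n<[2+s]² : suc n < suc (suc s) * suc (suc s)
  1+n<[2+s]² rewrite 1+n≡[1+s]² = *-mono-< (n<1+n (suc s)) (n<1+n (suc s))

isSPart-^* : ∀ {S p d} k → Prime p → ¬ S p → AllPrimeFactorsIn S d → IsSPart S (p ^ k * d) d
isSPart-^* {S} {p} {d} k p-prime p∉S d∈S = n∣m*n (p ^ k) , d∈S , maximal
  where
  instance
    d≢0 : NonZero d
    d≢0 = ≢-nonZero λ { refl → p∉S (d∈S p p-prime (divides 0 refl)) }
  maximal : ∀ e → e ∣ p ^ k * d → AllPrimeFactorsIn S e → e ≤ d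
  maximal e e∣p^kd e∈S =
    ∣⇒≤ (coprime-divisor-^ (prime∤⇒coprime p-prime (p∉S ∘ e∈S p p-prime)) k e∣p^kd)

pigeonhole-× : ∀ {m n₁ n₂} → m < n₁ * n₂ → (f : Fin n₁ × Fin n₂ → Fin m) →
               ∃₂ λ a b → a ≢ b × f a ≡ f b
pigeonhole-× {n₁ = n₁} {n₂} m<n₁n₂ f
  with i , j , i<j , fi≡fj ← Finₚ.pigeonhole m<n₁n₂ (f ∘ remQuot n₂) =
  remQuot n₂ i , remQuot n₂ j , Finₚ.<⇒≢ i<j ∘ remQuot-injective , fi≡fj
  where
  remQuot-injective : remQuot {n₁} n₂ i ≡ remQuot n₂ j → i ≡ j
  remQuot-injective eq = trans (sym (Finₚ.combine-remQuot {n₁} n₂ i))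
    (trans (cong (uncurry combine) eq) (Finₚ.combine-remQuot {n₁} n₂ j))

%ℕ-≡⇒∣- : ∀ a b q .{{_ : NonZero q}} → a ℤ.%ℕ q ≡ b ℤ.%ℕ q → + q ℤ∣.∣ a ℤ.- b
%ℕ-≡⇒∣- a b q a%q≡b%q = ℤ∣.divides (a ℤ./ℕ q ℤ.- b ℤ./ℕ q) (begin
  a ℤ.- b
    ≡⟨ cong₂ ℤ._-_ (ℤ.a≡a%ℕn+[a/ℕn]*n a q) (ℤ.a≡a%ℕn+[a/ℕn]*n b q) ⟩
  (+ (a ℤ.%ℕ q) ℤ.+ a ℤ./ℕ q ℤ.* + q) ℤ.- (+ (b ℤ.%ℕ q) ℤ.+ b ℤ./ℕ q ℤ.* + q)
    ≡⟨ cong (λ r → (+ r ℤ.+ a ℤ./ℕ q ℤ.* + q) ℤ.- (+ (b ℤ.%ℕ q) ℤ.+ b ℤ./ℕ q ℤ.* + q)) a%q≡b%q ⟩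
  (+ (b ℤ.%ℕ q) ℤ.+ a ℤ./ℕ q ℤ.* + q) ℤ.- (+ (b ℤ.%ℕ q) ℤ.+ b ℤ./ℕ q ℤ.* + q)
    ≡⟨ cancel (+ (b ℤ.%ℕ q)) (a ℤ./ℕ q) (b ℤ./ℕ q) (+ q) ⟩
  (a ℤ./ℕ q ℤ.- b ℤ./ℕ q) ℤ.* + q ∎)
  where
  open ≡-Reasoning
  cancel : ∀ r k l q → (r ℤ.+ k ℤ.* q) ℤ.- (r ℤ.+ l ℤ.* q) ≡ (k ℤ.- l) ℤ.* q
  cancel = ℤ-Solver.solve-∀

∣m-n∣<k : ∀ {m n k} → m < k → n < k → ∣ + m ℤ.- + n ∣ < k
∣m-n∣<k {m} {n} m<k n<k = begin-strict
  ∣ + m ℤ.- + n ∣ ≡⟨ cong ∣_∣ (ℤₚ.m-n≡m⊖n m n) ⟩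
  ∣ m ℤ.⊖ n ∣     ≤⟨ ℤₚ.∣m⊝n∣≤m⊔n m n ⟩
  m ⊔ n           <⟨ ⊔-pres-<m m<k n<k ⟩
  _               ∎
  where open ≤-Reasoning

m-n≡0⇒m≡n : ∀ {m n} → + m ℤ.- + n ≡ 0ℤ → m ≡ n
m-n≡0⇒m≡n {m} {n} = ℤₚ.+-injective ∘ ℤₚ.i-j≡0⇒i≡j (+ m) (+ n)

SmallSolution : ℕ → ℕ → ℤ → ℤ → Set
SmallSolution q n x y =
  ∃₂ λ u v → ¬ (u ≡ 0ℤ × v ≡ 0ℤ) × ∣ u ∣ < n × ∣ v ∣ < n × + q ℤ∣.∣ u ℤ.* y ℤ.- v ℤ.* x

thue : ∀ {q n} .{{_ : NonZero q}} → q < n * n → ∀ x y → SmallSolution q n x y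
thue {q} {n} q<n² x y = from-collision (pigeonhole-× q<n² residue)
  where
  combination : Fin n × Fin n → ℤ
  combination (i , j) = + toℕ i ℤ.* y ℤ.- + toℕ j ℤ.* x
  residue : Fin n × Fin n → Fin q
  residue a = fromℕ< (ℤ.n%ℕd<d (combination a) q)
  difference : ∀ i₁ j₁ i₂ j₂ x y → (i₁ ℤ.* y ℤ.- j₁ ℤ.* x) ℤ.- (i₂ ℤ.* y ℤ.- j₂ ℤ.* x)
             ≡ (i₁ ℤ.- i₂) ℤ.* y ℤ.- (j₁ ℤ.- j₂) ℤ.* x
  difference = ℤ-Solver.solve-∀
  from-collision : (∃₂ λ a b → a ≢ b × residue a ≡ residue b) → SmallSolution q n x y
  from-collision (a@(i₁ , j₁) , b@(i₂ , j₂) , a≢b , same-residue) =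
    + toℕ i₁ ℤ.- + toℕ i₂ , + toℕ j₁ ℤ.- + toℕ j₂ , a≢b ∘ a≡b ,
    ∣m-n∣<k (Finₚ.toℕ<n i₁) (Finₚ.toℕ<n i₂) , ∣m-n∣<k (Finₚ.toℕ<n j₁) (Finₚ.toℕ<n j₂) ,
    subst (+ q ℤ∣.∣_) (difference (+ toℕ i₁) (+ toℕ j₁) (+ toℕ i₂) (+ toℕ j₂) x y)
      (%ℕ-≡⇒∣- (combination a) (combination b) q same-%ℕ)
    where
    a≡b : (+ toℕ i₁ ℤ.- + toℕ i₂ ≡ 0ℤ) × (+ toℕ j₁ ℤ.- + toℕ j₂ ≡ 0ℤ) → a ≡ b
    a≡b (u≡0 , v≡0) =
      cong₂ _,_ (Finₚ.toℕ-injective (m-n≡0⇒m≡n u≡0)) (Finₚ.toℕ-injective (m-n≡0⇒m≡n v≡0))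
    same-%ℕ : combination a ℤ.%ℕ q ≡ combination b ℤ.%ℕ q
    same-%ℕ = trans (sym (Finₚ.toℕ-fromℕ< (ℤ.n%ℕd<d (combination a) q)))
      (trans (cong toℕ same-residue) (Finₚ.toℕ-fromℕ< (ℤ.n%ℕd<d (combination b) q)))

x²+2y² : ℕ → ℕ → ℕ
x²+2y² x y = x * x + 2 * (y * y)

x²+2y²ᶻ : ℤ → ℤ → ℤ
x²+2y²ᶻ x y = x ℤ.* x ℤ.+ + 2 ℤ.* (y ℤ.* y)

Represented : ℕ → Set
Represented n = ∃₂ λ x y → x²+2y² x y ≡ n

SmallMultipleRepresented : ℕ → Set
SmallMultipleRepresented q = ∃₂ λ x y → q ∣ x²+2y² x y × x²+2y² x y ≢ 0 × x²+2y² x y < 3 * q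

i*i≡∣i∣*∣i∣ : ∀ i → i ℤ.* i ≡ + ∣ i ∣ ℤ.* + ∣ i ∣
i*i≡∣i∣*∣i∣ (+ n)    = refl
i*i≡∣i∣*∣i∣ -[1+ n ] = refl

x²+2y²ᶻ≡x²+2y²∣∣ : ∀ x y → x²+2y²ᶻ x y ≡ + x²+2y² ∣ x ∣ ∣ y ∣
x²+2y²ᶻ≡x²+2y²∣∣ x y = begin
  x ℤ.* x ℤ.+ + 2 ℤ.* (y ℤ.* y)
    ≡⟨ cong₂ (λ c d → c ℤ.+ + 2 ℤ.* d) (i*i≡∣i∣*∣i∣ x) (i*i≡∣i∣*∣i∣ y) ⟩
  + a ℤ.* + a ℤ.+ + 2 ℤ.* (+ b ℤ.* + b)
    ≡⟨ cong₂ (λ c d → c ℤ.+ + 2 ℤ.* d) (ℤₚ.pos-* a a) (ℤₚ.pos-* b b) ⟨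
  + (a * a) ℤ.+ + 2 ℤ.* + (b * b)
    ≡⟨ cong (λ c → + (a * a) ℤ.+ c) (ℤₚ.pos-* 2 (b * b)) ⟨
  + (a * a) ℤ.+ + (2 * (b * b))
    ≡⟨ ℤₚ.pos-+ (a * a) (2 * (b * b)) ⟨
  + x²+2y² a b ∎
  where
  open ≡-Reasoning
  a b : ℕ
  a = ∣ x ∣
  b = ∣ y ∣

x²+2y²-% : ∀ x y n .{{_ : NonZero n}} → x²+2y² x y % n ≡ x²+2y² (x % n) (y % n) % n
x²+2y²-% x y n = begin
  x²+2y² x y % n
    ≡⟨ cong₂ (λ a b → x²+2y² a b % n) (m≡m%n+[m/n]*n x n) (m≡m%n+[m/n]*n y n) ⟩
  x²+2y² (r + k * n) (s + l * n) % n
    ≡⟨ cong (_% n) (expand r k s l n) ⟩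
  (x²+2y² r s + (k * (2 * r + k * n) + 2 * (l * (2 * s + l * n))) * n) % n
    ≡⟨ [m+kn]%n≡m%n (x²+2y² r s) (k * (2 * r + k * n) + 2 * (l * (2 * s + l * n))) n ⟩
  x²+2y² r s % n ∎
  where
  open ≡-Reasoning
  r s k l : ℕ
  r = x % n
  s = y % n
  k = x / n
  l = y / n
  expand : ∀ r k s l n → (r + k * n) * (r + k * n) + 2 * ((s + l * n) * (s + l * n))
         ≡ (r * r + 2 * (s * s)) + (k * (2 * r + k * n) + 2 * (l * (2 * s + l * n))) * n
  expand = solve-∀

odd⇒≡1∨3? : ∀ m → Dec (m % 2 ≡ 1 → m ≡ 1 ⊎ m ≡ 3)
odd⇒≡1∨3? m = (m % 2 ≟ 1) →-dec ((m ≟ 1) ⊎-dec (m ≟ 3))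

x²+2y²-odd-residues : ∀ (r s : Fin 8) → let m = x²+2y² (toℕ r) (toℕ s) % 8 in
                      m % 2 ≡ 1 → m ≡ 1 ⊎ m ≡ 3
x²+2y²-odd-residues =
  toWitness {a? = Finₚ.all? λ r → Finₚ.all? λ s → odd⇒≡1∨3? (x²+2y² (toℕ r) (toℕ s) % 8)} _

x²+2y²-odd⇒≡1∨3[mod8] : ∀ x y → let m = x²+2y² x y in m % 2 ≡ 1 → m % 8 ≡ 1 ⊎ m % 8 ≡ 3
x²+2y²-odd⇒≡1∨3[mod8] x y odd =
  subst (λ m → m ≡ 1 ⊎ m ≡ 3) (sym reduce) (x²+2y²-odd-residues r s residue-odd)
  where
  r s : Fin 8
  r = fromℕ< (m%n<n x 8)
  s = fromℕ< (m%n<n y 8)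
  reduce : x²+2y² x y % 8 ≡ x²+2y² (toℕ r) (toℕ s) % 8
  reduce = trans (x²+2y²-% x y 8) (sym (cong₂ (λ a b → x²+2y² a b % 8)
    (Finₚ.toℕ-fromℕ< (m%n<n x 8)) (Finₚ.toℕ-fromℕ< (m%n<n y 8))))
  residue-odd : x²+2y² (toℕ r) (toℕ s) % 8 % 2 ≡ 1
  residue-odd = trans (cong (_% 2) (sym reduce))
    (trans (m∣n⇒o%n%m≡o%m 2 8 (x²+2y² x y) (divides 4 refl)) odd)

odd-represented⇒≡1∨3[mod8] : ∀ {q} → ¬ 2 ∣ q → Represented q → q % 8 ≡ 1 ⊎ q % 8 ≡ 3
odd-represented⇒≡1∨3[mod8] 2∤q (a , b , refl) = x²+2y²-odd⇒≡1∨3[mod8] a b (¬2∣⇒%2≡1 _ 2∤q)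

x²+2y²≡0⇒ : ∀ x y → x²+2y² x y ≡ 0 → x ≡ 0 × y ≡ 0
x²+2y²≡0⇒ zero    zero    _  = refl , refl
x²+2y²≡0⇒ zero    (suc y) ()
x²+2y²≡0⇒ (suc x) y       ()

x²+2y²<3* : ∀ {x y s q} → x ≤ s → y ≤ s → s * s < q → x²+2y² x y < 3 * q
x²+2y²<3* x≤s y≤s s²<q =
  ≤-<-trans (+-mono-≤ (*-mono-≤ x≤s x≤s) (*-monoʳ-≤ 2 (*-mono-≤ y≤s y≤s))) (*-monoʳ-< 3 s²<q)

x²+2y²-double : ∀ x y → x²+2y² (x * 2) y ≡ 2 * x²+2y² y x
x²+2y²-double = expanded
  where
  expanded : ∀ x y → x * 2 * (x * 2) + 2 * (y * y) ≡ 2 * (y * y + 2 * (x * x))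
  expanded = solve-∀

prime∣x²+2y²⇒∣x : ∀ {p} x y → Prime p → p ∣ x²+2y² x y → p ∣ 2 * (y * y) → p ∣ x
prime∣x²+2y²⇒∣x {p} x y p-prime p∣Q p∣2y² =
  prime∣²⇒∣ x p-prime (∣m+n∣m⇒∣n (subst (p ∣_) (+-comm (x * x) (2 * (y * y))) p∣Q) p∣2y²)

2∣x²+2y²⇒2∣x : ∀ x y → 2 ∣ x²+2y² x y → 2 ∣ x
2∣x²+2y²⇒2∣x x y 2∣Q = prime∣x²+2y²⇒∣x x y prime[2] 2∣Q (m∣m*n (y * y))

coprime∧∣x²+2y²⇒∤y : ∀ {x y q} → Coprime x y → Prime q → q ∣ x²+2y² x y → ¬ q ∣ y
coprime∧∣x²+2y²⇒∤y {x} {y} {q} x⊥y q-prime q∣Q q∣y =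
  ¬prime[1] (subst Prime (x⊥y (q∣x , q∣y)) q-prime)
  where
  q∣x : q ∣ x
  q∣x = prime∣x²+2y²⇒∣x x y q-prime q∣Q (∣n⇒∣m*n 2 (∣m⇒∣m*n y q∣y))

∣x²+2y²ᶻ⇒∣y²*x²+2y²ᶻ : ∀ {k} x y u v → k ℤ∣.∣ u ℤ.* y ℤ.- v ℤ.* x → k ℤ∣.∣ x²+2y²ᶻ x y →
                       k ℤ∣.∣ y ℤ.* y ℤ.* x²+2y²ᶻ u v
∣x²+2y²ᶻ⇒∣y²*x²+2y²ᶻ {k} x y u v k∣uy-vx k∣Q[x,y] =
  subst (k ℤ∣.∣_) (sym (identity x y u v))
    (ℤ∣.∣m∣n⇒∣m+n (ℤ∣.∣m⇒∣m*n (u ℤ.* y ℤ.+ v ℤ.* x) k∣uy-vx) (ℤ∣.∣n⇒∣m*n (v ℤ.* v) k∣Q[x,y]))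
  where
  identity : ∀ x y u v → y ℤ.* y ℤ.* (u ℤ.* u ℤ.+ + 2 ℤ.* (v ℤ.* v))
           ≡ (u ℤ.* y ℤ.- v ℤ.* x) ℤ.* (u ℤ.* y ℤ.+ v ℤ.* x) ℤ.+ v ℤ.* v ℤ.* (x ℤ.* x ℤ.+ + 2 ℤ.* (y ℤ.* y))
  identity = ℤ-Solver.solve-∀

prime∣x²+2y²-transfer : ∀ {q x y} u v → Prime q → ¬ q ∣ y → q ∣ x²+2y² x y →
                        + q ℤ∣.∣ u ℤ.* + y ℤ.- v ℤ.* + x → q ∣ x²+2y² (∣ u ∣) (∣ v ∣)
prime∣x²+2y²-transfer {q} {x} {y} u v q-prime q∤y q∣Q[x,y] q∣uy-vx =
  prime∣*∧∤⇒∣ (y * y) q-prime (q∤y ∘ prime∣²⇒∣ y q-prime) q∣y²Q[u,v]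
  where
  ∣y²Q[u,v]∣ : ∣ + y ℤ.* + y ℤ.* x²+2y²ᶻ u v ∣ ≡ y * y * x²+2y² (∣ u ∣) (∣ v ∣)
  ∣y²Q[u,v]∣ = trans (ℤₚ.abs-* (+ y ℤ.* + y) (x²+2y²ᶻ u v))
    (cong₂ _*_ (ℤₚ.abs-* (+ y) (+ y)) (cong ∣_∣ (x²+2y²ᶻ≡x²+2y²∣∣ u v)))
  q∣Qᶻ[x,y] : + q ℤ∣.∣ x²+2y²ᶻ (+ x) (+ y)
  q∣Qᶻ[x,y] = ℤ∣.∣ᵤ⇒∣ (subst (q ∣_) (cong ∣_∣ (sym (x²+2y²ᶻ≡x²+2y²∣∣ (+ x) (+ y)))) q∣Q[x,y])
  q∣y²Q[u,v] : q ∣ y * y * x²+2y² (∣ u ∣) (∣ v ∣)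
  q∣y²Q[u,v] = subst (q ∣_) ∣y²Q[u,v]∣
    (ℤ∣.∣⇒∣ᵤ (∣x²+2y²ᶻ⇒∣y²*x²+2y²ᶻ (+ x) (+ y) u v q∣uy-vx q∣Qᶻ[x,y]))

prime∣x²+2y²⇒small-multiple : ∀ {q} x y → Prime q → ¬ q ∣ y → q ∣ x²+2y² x y →
                              SmallMultipleRepresented q
prime∣x²+2y²⇒small-multiple {q} x y q-prime q∤y q∣Q with s , s²≤q , q<[1+s]² ← floor-sqrt q =
  from-thue (thue q<[1+s]² (+ x) (+ y))
  where
  instance
    q≢0 : NonZero q
    q≢0 = prime⇒nonZero q-prime
  from-thue : SmallSolution q (suc s) (+ x) (+ y) → SmallMultipleRepresented q
  from-thue (u , v , uv≢0 , ∣u∣<1+s , ∣v∣<1+s , q∣uy-vx) =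
    ∣ u ∣ , ∣ v ∣ ,
    prime∣x²+2y²-transfer u v q-prime q∤y q∣Q q∣uy-vx ,
    uv≢0 ∘ map ℤₚ.∣i∣≡0⇒i≡0 ℤₚ.∣i∣≡0⇒i≡0 ∘ x²+2y²≡0⇒ ∣ u ∣ ∣ v ∣ ,
    x²+2y²<3* (s≤s⁻¹ ∣u∣<1+s) (s≤s⁻¹ ∣v∣<1+s) (≤∧≢⇒< s²≤q (prime⇒≢square s q-prime))

x²+2y²≡2*⇒represented : ∀ {x y n} → x²+2y² x y ≡ 2 * n → Represented n
x²+2y²≡2*⇒represented {x} {y} {n} Q≡2n
  with 2∣x²+2y²⇒2∣x x y (divides n (trans Q≡2n (*-comm 2 n)))
... | divides c refl = y , c , *-cancelˡ-≡ (x²+2y² y c) n 2 (trans (sym (x²+2y²-double c y)) Q≡2n)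

small-multiple⇒represented : ∀ {q} → SmallMultipleRepresented q → Represented q
small-multiple⇒represented (_ , _ , divides 0 Q≡0 , Q≢0 , _) = contradiction Q≡0 Q≢0
small-multiple⇒represented {q} (x , y , divides 1 Q≡q , _) = x , y , trans Q≡q (*-identityˡ q)
small-multiple⇒represented (x , y , divides 2 Q≡2q , _) = x²+2y²≡2*⇒represented {x} {y} Q≡2q
small-multiple⇒represented {q} (_ , _ , divides (suc (suc (suc k))) Q≡kq , _ , Q<3q) =
  contradiction Q<3q (≤⇒≯ (subst (3 * q ≤_) (sym Q≡kq) (*-monoˡ-≤ q (m≤m+n 3 k))))

prime∣x²+2y²⇒S₂ : ∀ {x y q} → Coprime x y → Prime q → q ≢ 2 → q ∣ x²+2y² x y → S₂ q
prime∣x²+2y²⇒S₂ {x} {y} x⊥y q-prime q≢2 q∣Q = q-prime ,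
  odd-represented⇒≡1∨3[mod8] (prime≢2⇒¬2∣ q-prime q≢2) (small-multiple⇒represented
    (prime∣x²+2y²⇒small-multiple x y q-prime (coprime∧∣x²+2y²⇒∤y x⊥y q-prime q∣Q) q∣Q))

2∉S₂ : ¬ S₂ 2
2∉S₂ (_ , inj₁ ())
2∉S₂ (_ , inj₂ ())

odd-divisor-of-x²+2y²⇒S₂ : ∀ {x y d} → Coprime x y → ¬ 2 ∣ d → d ∣ x²+2y² x y →
                           AllPrimeFactorsIn S₂ d
odd-divisor-of-x²+2y²⇒S₂ x⊥y 2∤d d∣Q q q-prime q∣d =
  prime∣x²+2y²⇒S₂ x⊥y q-prime (λ { refl → 2∤d q∣d }) (∣-trans q∣d d∣Q)

x²+2y²≡2^k*odd : ∀ {x y} → Coprime x y → ∃₂ λ k d → k ≤ 1 × ¬ 2 ∣ d × x²+2y² x y ≡ 2 ^ k * d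
x²+2y²≡2^k*odd {x} {y} x⊥y with 2 ∣? x
... | no 2∤x = 0 , x²+2y² x y , z≤n , 2∤x ∘ 2∣x²+2y²⇒2∣x x y , sym (*-identityˡ (x²+2y² x y))
... | yes 2∣x@(divides c refl) = 1 , x²+2y² y c , ≤-refl , 2∤y ∘ 2∣x²+2y²⇒2∣x y c , x²+2y²-double c y
  where
  2∤y : ¬ 2 ∣ y
  2∤y 2∣y with () ← x⊥y (2∣x , 2∣y)

x²+2y²-S₂-part : ∀ {x y} → Coprime x y → ∃[ d ] (IsSPart S₂ (x²+2y² x y) d × x²+2y² x y ≤ 2 * d)
x²+2y²-S₂-part {x} {y} x⊥y with k , d , k≤1 , 2∤d , Q≡2^kd ← x²+2y²≡2^k*odd x⊥y =
  d , subst (λ N → IsSPart S₂ N d × N ≤ 2 * d) (sym Q≡2^kd)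
        (isSPart-^* k prime[2] 2∉S₂ (odd-divisor-of-x²+2y²⇒S₂ x⊥y 2∤d d∣Q) , *-monoˡ-≤ d (^-monoʳ-≤ 2 k≤1))
  where
  d∣Q : d ∣ x²+2y² x y
  d∣Q = subst (d ∣_) (sym Q≡2^kd) (n∣m*n (2 ^ k))

corollary2p6 : ∀ (p : ℕ) → P-S₂ p →
    ∃[ d ] (IsSPart S₂ (p ∸ 1) d × p ∸ 1 ≤ 2 * d)
corollary2p6 p (_ , x , y , p≡Qᶻ+1 , gcd≡1) =
  subst (λ n → ∃[ d ] (IsSPart S₂ n d × n ≤ 2 * d)) (sym p∸1≡Q)
    (x²+2y²-S₂-part (gcd≡1⇒coprime {∣ x ∣} {∣ y ∣} (cong ∣_∣ gcd≡1)))
  where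
  Q : ℕ
  Q = x²+2y² (∣ x ∣) (∣ y ∣)
  p≡Q+1 : p ≡ Q + 1
  p≡Q+1 = ℤₚ.+-injective (begin
    + p                      ≡⟨ p≡Qᶻ+1 ⟩
    x²+2y²ᶻ x y ℤ.+ + 1       ≡⟨ cong (ℤ._+ + 1) (x²+2y²ᶻ≡x²+2y²∣∣ x y) ⟩
    + Q ℤ.+ + 1               ≡⟨ ℤₚ.pos-+ Q 1 ⟨
    + (Q + 1)                 ∎)
    where open ≡-Reasoning
  p∸1≡Q : p ∸ 1 ≡ Q
  p∸1≡Q = trans (cong (_∸ 1) p≡Q+1) (m+n∸n≡m Q 1)
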